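{- Let $G=(V,E)$ be a finite simple graph without isolated vertices, and consider a position of the Disjoint Domination Game on $G$ with current disjoint color classes $V_p,V_b$. Let $C$ be a connected component of $G$ and suppose there is an uncolored vertex $u\in V(C)$ and a color $c$ such that coloring $u$ with $c$ is legal and after this coloring every vertex of $C$ is dominated by both color classes. Then, from the current position on, no sequence of legal moves (by either player, using either color) makes the closed neighborhood of some vertex of $C$ monochromatic.
   Context: For a vertex $v$, $N[v]$ denotes its closed neighborhood. In the Disjoint Domination Game players color uncolored vertices purple ($p$) or blue ($b$); with $V_p,V_b$ the current color classes, coloring $v$ with $c$ is legal iff $v\notin V_p\cup V_b$ and some $w\in N[v]$ has $N[w]\cap V_c=\emptyset$. A vertex $w$ is dominated by color $c$ if $N[w]\cap V_c\neq\emptyset$. A closed neighborhood is monochromatic if all its vertices are colored with the same color. -}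

module Defs where

open import Data.Nat using (ℕ)
open import Data.Fin using (Fin; _≟_)
open import Data.Maybe using (Maybe; just; nothing)
open import Data.Product using (Σ; ∃; _×_; _,_)
open import Data.Sum using (_⊎_)
open import Relation.Nullary using (¬_; yes; no)
open import Relation.Binary.PropositionalEquality using (_≡_)
open import Relation.Binary.Construct.Closure.ReflexiveTransitive using (Star)

record SimpleGraph (n : ℕ) : Set₁ where
  field
    Adj   : Fin n → Fin n → Set
    sym   : ∀ {x y} → Adj x y → Adj y x
    irrefl : ∀ {x} → ¬ Adj x x
open SimpleGraph public

NoIsolated : ∀ {n} → SimpleGraph n → Set
NoIsolated {n} G = ∀ (v : Fin n) → ∃ λ w → Adj G v w

InN : ∀ {n} → SimpleGraph n → Fin n → Fin n → Set
InN G x y = y ≡ x ⊎ Adj G x y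

data Color : Set where
  p b : Color

-- A position: each vertex is uncolored (nothing) or colored; V_p, V_b are
-- the preimages of just p / just b, hence automatically disjoint.
Position : ℕ → Set
Position n = Fin n → Maybe Color

Dominated : ∀ {n} → SimpleGraph n → Position n → Color → Fin n → Set
Dominated G pos c w = ∃ λ y → InN G w y × pos y ≡ just c

Legal : ∀ {n} → SimpleGraph n → Position n → Fin n → Color → Set
Legal G pos v c =
  pos v ≡ nothing ×
  (∃ λ w → InN G v w × (∀ y → InN G w y → ¬ (pos y ≡ just c)))

colour : ∀ {n} → Position n → Fin n → Color → Position n
colour pos v c y with y ≟ v
... | yes _ = just c
... | no _ = pos y

data Move {n} (G : SimpleGraph n) : Position n → Position n → Set where
  move : ∀ {pos v c} → Legal G pos v c → Move G pos (colour pos v c)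

Reachable : ∀ {n} → SimpleGraph n → Position n → Position n → Set
Reachable G = Star (Move G)

Connected : ∀ {n} → SimpleGraph n → Fin n → Fin n → Set
Connected G = Star (Adj G)

Monochromatic : ∀ {n} → SimpleGraph n → Position n → Fin n → Set
Monochromatic G pos x = ∃ λ c → ∀ y → InN G x y → pos y ≡ just c

-- Let q be the position after colouring u with c. Every later position extends the current one,
-- so the only vertex where it could disagree with q is u. But u can never receive the other colour
-- e ≠ c: each w ∈ N[u] lies in C and is e-dominated in q by a vertex other than u, i.e. by a vertex
-- already coloured e now, so no w ∈ N[u] is ever free of e. Hence every reachable position is
-- consistent with q, and in q each N[x] with x ∈ C contains both colours.
module Submission where

open import Defs hiding (sym)
open import Data.Fin using (Fin; _≟_)
open import Data.Maybe using (just; nothing)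
open import Data.Maybe.Properties using (just-injective)
open import Data.Product using (_×_; _,_; proj₁; proj₂)
open import Data.Sum using (_⊎_; inj₁; inj₂)
open import Data.Empty using (⊥-elim)
open import Relation.Nullary using (¬_; yes; no)
open import Relation.Binary.PropositionalEquality using (_≡_; refl; sym; trans)
open import Relation.Binary.Construct.Closure.ReflexiveTransitive using (ε; _◅_)

colour-just : ∀ {n} (pos : Position n) v c y {d} →
  colour pos v c y ≡ just d → (y ≡ v × c ≡ d) ⊎ pos y ≡ just d
colour-just pos v c y eq with y ≟ v
... | yes y≡v = inj₁ (y≡v , just-injective eq)
... | no _ = inj₂ eq

just≢nothing : ∀ {A : Set} {x : A} → ¬ just x ≡ nothing
just≢nothing ()

_⊑_ : ∀ {n} → Position n → Position n → Set
a ⊑ a′ = ∀ y {d} → a y ≡ just d → a′ y ≡ just d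

⊑-trans : ∀ {n} {a a′ a″ : Position n} → a ⊑ a′ → a′ ⊑ a″ → a ⊑ a″
⊑-trans a⊑a′ a′⊑a″ y ay = a′⊑a″ y (a⊑a′ y ay)

Move⇒⊑ : ∀ {n} {G : SimpleGraph n} {a a′} → Move G a a′ → a ⊑ a′
Move⇒⊑ (move {v = v} (av≡nothing , _)) y ay with y ≟ v
... | yes refl = ⊥-elim (just≢nothing (trans (sym ay) av≡nothing))
... | no _ = ay

Consistent : ∀ {n} → Position n → Position n → Set
Consistent q a = ∀ y {d e} → q y ≡ just d → a y ≡ just e → d ≡ e

consistent⇒¬Monochromatic : ∀ {n} (G : SimpleGraph n) {q a : Position n} {x} →
  Consistent q a → Dominated G q p x → Dominated G q b x → ¬ Monochromatic G a x
consistent⇒¬Monochromatic G q~a _ (y , yN , qy) (p , mono) with () ← q~a y qy (mono y yN)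
consistent⇒¬Monochromatic G q~a (y , yN , qy) _ (b , mono) with () ← q~a y qy (mono y yN)

∀-Color : ∀ {ℓ} {P : Color → Set ℓ} → P p × P b → ∀ e → P e
∀-Color (Pp , _) p = Pp
∀-Color (_ , Pb) b = Pb

InN⇒Connected : ∀ {n} {G : SimpleGraph n} {u w} → InN G u w → Connected G u w
InN⇒Connected (inj₁ refl) = ε
InN⇒Connected (inj₂ adj) = adj ◅ ε

module HypotheticalMove {n} (G : SimpleGraph n) (pos : Position n) (u : Fin n) (c : Color) where

  q : Position n
  q = colour pos u c

  ColoursUOnlyWithC : Position n → Set
  ColoursUOnlyWithC a = ∀ {e} → a u ≡ just e → e ≡ c

  legal-at-u⇒≡c : ∀ {a e} → pos ⊑ a → Legal G a u e →
    (∀ w → InN G u w → Dominated G q e w) → e ≡ c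
  legal-at-u⇒≡c pos⊑a (_ , w , wN , w-free) dom with dom w wN
  ... | z , zN , qz with colour-just pos u c z qz
  ...   | inj₁ (_ , c≡e) = sym c≡e
  ...   | inj₂ pos-z = ⊥-elim (w-free z zN (pos⊑a z pos-z))

  N[u]-BothDominated : Set
  N[u]-BothDominated = ∀ w → InN G u w → ∀ e → Dominated G q e w

  Invariant : Position n → Set
  Invariant a = pos ⊑ a × ColoursUOnlyWithC a

  Move-preserves-Invariant : N[u]-BothDominated →
    ∀ {a a′} → Move G a a′ → Invariant a → Invariant a′
  Move-preserves-Invariant dom m@(move {pos = a} {v = v} {c = e} legal) (pos⊑a , at-u) =
    ⊑-trans pos⊑a (Move⇒⊑ m) , at-u′
    where
    at-u′ : ColoursUOnlyWithC (colour a v e)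
    at-u′ a′u with colour-just a v e u a′u
    ... | inj₁ (refl , refl) = legal-at-u⇒≡c pos⊑a legal (λ w wN → dom w wN e)
    ... | inj₂ a-u = at-u a-u

  Reachable-preserves-Invariant : N[u]-BothDominated →
    ∀ {a a′} → Reachable G a a′ → Invariant a → Invariant a′
  Reachable-preserves-Invariant dom ε inv = inv
  Reachable-preserves-Invariant dom (m ◅ ms) inv =
    Reachable-preserves-Invariant dom ms (Move-preserves-Invariant dom m inv)

  Invariant-initial : Legal G pos u c → Invariant pos
  Invariant-initial (pos-u≡nothing , _) =
    (λ _ py → py) , λ pos-u → ⊥-elim (just≢nothing (trans (sym pos-u) pos-u≡nothing))

  Invariant⇒Consistent : ∀ {a} → Invariant a → Consistent q a
  Invariant⇒Consistent (pos⊑a , at-u) y qy ay with colour-just pos u c y qy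
  ... | inj₁ (refl , refl) = sym (at-u ay)
  ... | inj₂ pos-y = just-injective (trans (sym (pos⊑a y pos-y)) ay)

mainTheorem13 : ∀ {n} (G : SimpleGraph n) → NoIsolated G →
    (pos : Position n) (u : Fin n) (c : Color) →
    Legal G pos u c →
    (∀ x → Connected G u x →
       Dominated G (colour pos u c) p x × Dominated G (colour pos u c) b x) →
    ∀ pos′ → Reachable G pos pos′ →
    ∀ x → Connected G u x → ¬ Monochromatic G pos′ x
mainTheorem13 G _ pos u c legal dom pos′ reach x ux =
  consistent⇒¬Monochromatic G q~pos′ (proj₁ (dom x ux)) (proj₂ (dom x ux))
  where
  open HypotheticalMove G pos u c
  dom-N[u] : N[u]-BothDominated
  dom-N[u] w wN = ∀-Color {P = λ e → Dominated G q e w} (dom w (InN⇒Connected {G = G} wN))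
  q~pos′ : Consistent q pos′
  q~pos′ = Invariant⇒Consistent (Reachable-preserves-Invariant dom-N[u] reach (Invariant-initial legal))
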